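{- Let $\mathcal{P}$ be a Fitting program over a bilattice $\mathcal{B}$ as in the context, and $\alpha\in\{\mathcal{F},\mathcal{T},\mathcal{U},\mathcal{I}\}$. Then $Fix^{\alpha}_{\mathcal{U}}=Fix^{\alpha}_{\mathcal{F}}\otimes Fix^{\alpha}_{\mathcal{T}}$, $Fix^{\alpha}_{\mathcal{I}}=Fix^{\alpha}_{\mathcal{F}}\oplus Fix^{\alpha}_{\mathcal{T}}$, $Fix^{\alpha}_{\mathcal{F}}=Fix^{\alpha}_{\mathcal{U}}\wedge Fix^{\alpha}_{\mathcal{I}}$, and $Fix^{\alpha}_{\mathcal{T}}=Fix^{\alpha}_{\mathcal{U}}\vee Fix^{\alpha}_{\mathcal{I}}$.
   Context: A bilattice $\langle \mathcal{B},\leq_t,\leq_k\rangle$ is a nonempty set with two partial orders, each making $\mathcal{B}$ a complete lattice. Meet/join under $\leq_t$ are $\wedge,\vee$ (infinitary $\bigwedge,\bigvee$); under $\leq_k$ are $\otimes,\oplus$ (infinitary $\bigotimes,\bigoplus$). Bottom/top under $\leq_t$ are $\mathcal{F},\mathcal{T}$; under $\leq_k$ are $\mathcal{U},\mathcal{I}$. Standing assumptions: $\mathcal{B}$ is infinitely distributive, satisfies the infinitary interlacing conditions (each of $\wedge,\vee,\otimes,\oplus$ and their infinitary versions is monotone with respect to both orderings), and has a negation $\neg$ (an involution reversing $\leq_t$ and preserving $\leq_k$). Fitting program: formulas are built from literals (atoms and negated atoms) and elements of $\mathcal{B}$ using $\wedge,\vee,\otimes,\oplus,\exists,\forall$; a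 clause is $P(x_1,\dots,x_n)\leftarrow\phi(x_1,\dots,x_n)$ with free variables of $\phi$ among the $x_i$; a program is a finite set of clauses with no predicate letter heading more than one clause. Inst-$\mathcal{P}$ is the set of ground instances of its clauses. A built-in predicate $equal(s,t)$ has value $\mathcal{T}$ if $s=t$ and $\mathcal{F}$ otherwise. Valuations are maps from ground atoms to $\mathcal{B}$; $\mathcal{V}(\mathcal{B})$ is the set of valuations with pointwise orders and operations $\wedge,\vee,\otimes,\oplus$. Contrajoin $v\bigtriangleup w$ on closed formulas: $v\bigtriangleup w(A)=v(A)$, $v\bigtriangleup w(\neg A)=\neg w(A)$ for ground atoms, $v\bigtriangleup w(\beta)=\beta$ for $\beta\in\mathcal{B}$, commuting with $\wedge,\vee,\otimes,\oplus$, with $\exists$ as $\bigvee$ and $\forall$ as $\bigwedge$ over closed-term instances. $\Psi^{\alpha}_{\mathcal{P}}(v,w)(A)=\alpha$ if the ground atom $A$ heads no member of Inst-$\mathcal{P}$, and $=v\bigtriangleup w(B)$ if $A\leftarrow B\in$ Inst-$\mathcal{P}$. $v_\alpha$ is the constant valuation $\alpha$. $\Psi'^{\alpha}_{\mathcal{P}}(v)$ is the limit of the transfinite sequence $a_0=v_\alpha$, $a_{n}=\Psi^{\alpha}_{\mathcal{P}}(a_{n-1},v)$ at successors, and at limits $\lambda$: $a_\lambda=\bigvee_{n<\lambda}\Psi^{\alpha}_{\mathcal{P}}(a_n,v)$ if $\alpha=\mathcal{F}$, $\bigwedge_{n<\lambda}$ if $\alpha=\mathcal{T}$, $\bigoplus_{n<\lambda}$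 if $\alpha=\mathcal{U}$, $\bigotimes_{n<\lambda}$ if $\alpha=\mathcal{I}$ (this is the $\leq_t$-least, $\leq_t$-greatest, $\leq_k$-least, $\leq_k$-greatest fixpoint of $x\mapsto\Psi^{\alpha}_{\mathcal{P}}(x,v)$, respectively). $\Psi'^{\alpha}_{\mathcal{P}}$ is monotone for $\leq_k$ and anti-monotone for $\leq_t$. $Fix^{\alpha}_{\mathcal{U}}$ and $Fix^{\alpha}_{\mathcal{I}}$ denote the $\leq_k$-least and $\leq_k$-greatest fixpoints of $\Psi'^{\alpha}_{\mathcal{P}}$. $Fix^{\alpha}_{\mathcal{F}}$ and $Fix^{\alpha}_{\mathcal{T}}$ denote the extreme oscillation points of $\Psi'^{\alpha}_{\mathcal{P}}$ under $\leq_t$, i.e. the $\leq_t$-least and $\leq_t$-greatest fixpoints of $\Psi'^{\alpha}_{\mathcal{P}}\circ\Psi'^{\alpha}_{\mathcal{P}}$ (they satisfy $\Psi'^{\alpha}_{\mathcal{P}}(Fix^{\alpha}_{\mathcal{F}})=Fix^{\alpha}_{\mathcal{T}}$ and $\Psi'^{\alpha}_{\mathcal{P}}(Fix^{\alpha}_{\mathcal{T}})=Fix^{\alpha}_{\mathcal{F}}$). -}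

module Defs where

open import Data.Nat using (ℕ; suc)
open import Data.Fin using (Fin; zero; suc)
open import Data.Maybe using (Maybe; just; nothing)
open import Data.List using (List)
open import Data.List.Membership.Propositional using (_∈_)
open import Data.Product using (Σ; _,_; proj₁; ∃)
open import Relation.Binary.PropositionalEquality using (_≡_)
open import Relation.Binary.Structures using (IsPartialOrder)

record Bilattice : Set₁ where
  infixr 7 _∧_ _⊗_
  infixr 6 _∨_ _⊕_
  field
    Carrier : Set
    _≤t_ _≤k_ : Carrier → Carrier → Set
    ≤t-po : IsPartialOrder _≡_ _≤t_
    ≤k-po : IsPartialOrder _≡_ _≤k_
    _∧_ _∨_ _⊗_ _⊕_ : Carrier → Carrier → Carrier
    ∧-lb₁ : ∀ x y → (x ∧ y) ≤t x
    ∧-lb₂ : ∀ x y → (x ∧ y) ≤t y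
    ∧-glb : ∀ {x y z} → z ≤t x → z ≤t y → z ≤t (x ∧ y)
    ∨-ub₁ : ∀ x y → x ≤t (x ∨ y)
    ∨-ub₂ : ∀ x y → y ≤t (x ∨ y)
    ∨-lub : ∀ {x y z} → x ≤t z → y ≤t z → (x ∨ y) ≤t z
    ⊗-lb₁ : ∀ x y → (x ⊗ y) ≤k x
    ⊗-lb₂ : ∀ x y → (x ⊗ y) ≤k y
    ⊗-glb : ∀ {x y z} → z ≤k x → z ≤k y → z ≤k (x ⊗ y)
    ⊕-ub₁ : ∀ x y → x ≤k (x ⊕ y)
    ⊕-ub₂ : ∀ x y → y ≤k (x ⊕ y)
    ⊕-lub : ∀ {x y z} → x ≤k z → y ≤k z → (x ⊕ y) ≤k z
    ⋀ ⋁ ⨂ ⨁ : {I : Set} → (I → Carrier) → Carrier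
    ⋀-lb : ∀ {I} (f : I → Carrier) i → ⋀ f ≤t f i
    ⋀-glb : ∀ {I} (f : I → Carrier) {z} → (∀ i → z ≤t f i) → z ≤t ⋀ f
    ⋁-ub : ∀ {I} (f : I → Carrier) i → f i ≤t ⋁ f
    ⋁-lub : ∀ {I} (f : I → Carrier) {z} → (∀ i → f i ≤t z) → ⋁ f ≤t z
    ⨂-lb : ∀ {I} (f : I → Carrier) i → ⨂ f ≤k f i
    ⨂-glb : ∀ {I} (f : I → Carrier) {z} → (∀ i → z ≤k f i) → z ≤k ⨂ f
    ⨁-ub : ∀ {I} (f : I → Carrier) i → f i ≤k ⨁ f
    ⨁-lub : ∀ {I} (f : I → Carrier) {z} → (∀ i → f i ≤k z) → ⨁ f ≤k z
    𝓕 𝓣 𝓤 𝓘 : Carrier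
    𝓕-bot : ∀ x → 𝓕 ≤t x
    𝓣-top : ∀ x → x ≤t 𝓣
    𝓤-bot : ∀ x → 𝓤 ≤k x
    𝓘-top : ∀ x → x ≤k 𝓘
    ∧-mono-t : ∀ {a b c d} → a ≤t b → c ≤t d → (a ∧ c) ≤t (b ∧ d)
    ∧-mono-k : ∀ {a b c d} → a ≤k b → c ≤k d → (a ∧ c) ≤k (b ∧ d)
    ∨-mono-t : ∀ {a b c d} → a ≤t b → c ≤t d → (a ∨ c) ≤t (b ∨ d)
    ∨-mono-k : ∀ {a b c d} → a ≤k b → c ≤k d → (a ∨ c) ≤k (b ∨ d)
    ⊗-mono-t : ∀ {a b c d} → a ≤t b → c ≤t d → (a ⊗ c) ≤t (b ⊗ d)
    ⊗-mono-k : ∀ {a b c d} → a ≤k b → c ≤k d → (a ⊗ c) ≤k (b ⊗ d)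
    ⊕-mono-t : ∀ {a b c d} → a ≤t b → c ≤t d → (a ⊕ c) ≤t (b ⊕ d)
    ⊕-mono-k : ∀ {a b c d} → a ≤k b → c ≤k d → (a ⊕ c) ≤k (b ⊕ d)
    ⋀-mono-t : ∀ {I} {f g : I → Carrier} → (∀ i → f i ≤t g i) → ⋀ f ≤t ⋀ g
    ⋀-mono-k : ∀ {I} {f g : I → Carrier} → (∀ i → f i ≤k g i) → ⋀ f ≤k ⋀ g
    ⋁-mono-t : ∀ {I} {f g : I → Carrier} → (∀ i → f i ≤t g i) → ⋁ f ≤t ⋁ g
    ⋁-mono-k : ∀ {I} {f g : I → Carrier} → (∀ i → f i ≤k g i) → ⋁ f ≤k ⋁ g
    ⨂-mono-t : ∀ {I} {f g : I → Carrier} → (∀ i → f i ≤t g i) → ⨂ f ≤t ⨂ g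
    ⨂-mono-k : ∀ {I} {f g : I → Carrier} → (∀ i → f i ≤k g i) → ⨂ f ≤k ⨂ g
    ⨁-mono-t : ∀ {I} {f g : I → Carrier} → (∀ i → f i ≤t g i) → ⨁ f ≤t ⨁ g
    ⨁-mono-k : ∀ {I} {f g : I → Carrier} → (∀ i → f i ≤k g i) → ⨁ f ≤k ⨁ g
    ∧-distrib-∨ : ∀ a b c → a ∧ (b ∨ c) ≡ (a ∧ b) ∨ (a ∧ c)
    ∧-distrib-⊗ : ∀ a b c → a ∧ (b ⊗ c) ≡ (a ∧ b) ⊗ (a ∧ c)
    ∧-distrib-⊕ : ∀ a b c → a ∧ (b ⊕ c) ≡ (a ∧ b) ⊕ (a ∧ c)
    ∨-distrib-∧ : ∀ a b c → a ∨ (b ∧ c) ≡ (a ∨ b) ∧ (a ∨ c)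
    ∨-distrib-⊗ : ∀ a b c → a ∨ (b ⊗ c) ≡ (a ∨ b) ⊗ (a ∨ c)
    ∨-distrib-⊕ : ∀ a b c → a ∨ (b ⊕ c) ≡ (a ∨ b) ⊕ (a ∨ c)
    ⊗-distrib-∧ : ∀ a b c → a ⊗ (b ∧ c) ≡ (a ⊗ b) ∧ (a ⊗ c)
    ⊗-distrib-∨ : ∀ a b c → a ⊗ (b ∨ c) ≡ (a ⊗ b) ∨ (a ⊗ c)
    ⊗-distrib-⊕ : ∀ a b c → a ⊗ (b ⊕ c) ≡ (a ⊗ b) ⊕ (a ⊗ c)
    ⊕-distrib-∧ : ∀ a b c → a ⊕ (b ∧ c) ≡ (a ⊕ b) ∧ (a ⊕ c)
    ⊕-distrib-∨ : ∀ a b c → a ⊕ (b ∨ c) ≡ (a ⊕ b) ∨ (a ⊕ c)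
    ⊕-distrib-⊗ : ∀ a b c → a ⊕ (b ⊗ c) ≡ (a ⊕ b) ⊗ (a ⊕ c)
    -- infinitary distributivity (over nonempty families)
    ∧-distrib-⋁ : ∀ {I} (i₀ : I) a (f : I → Carrier) → a ∧ ⋁ f ≡ ⋁ (λ i → a ∧ f i)
    ∧-distrib-⨂ : ∀ {I} (i₀ : I) a (f : I → Carrier) → a ∧ ⨂ f ≡ ⨂ (λ i → a ∧ f i)
    ∧-distrib-⨁ : ∀ {I} (i₀ : I) a (f : I → Carrier) → a ∧ ⨁ f ≡ ⨁ (λ i → a ∧ f i)
    ∨-distrib-⋀ : ∀ {I} (i₀ : I) a (f : I → Carrier) → a ∨ ⋀ f ≡ ⋀ (λ i → a ∨ f i)
    ∨-distrib-⨂ : ∀ {I} (i₀ : I) a (f : I → Carrier) → a ∨ ⨂ f ≡ ⨂ (λ i → a ∨ f i)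
    ∨-distrib-⨁ : ∀ {I} (i₀ : I) a (f : I → Carrier) → a ∨ ⨁ f ≡ ⨁ (λ i → a ∨ f i)
    ⊗-distrib-⋀ : ∀ {I} (i₀ : I) a (f : I → Carrier) → a ⊗ ⋀ f ≡ ⋀ (λ i → a ⊗ f i)
    ⊗-distrib-⋁ : ∀ {I} (i₀ : I) a (f : I → Carrier) → a ⊗ ⋁ f ≡ ⋁ (λ i → a ⊗ f i)
    ⊗-distrib-⨁ : ∀ {I} (i₀ : I) a (f : I → Carrier) → a ⊗ ⨁ f ≡ ⨁ (λ i → a ⊗ f i)
    ⊕-distrib-⋀ : ∀ {I} (i₀ : I) a (f : I → Carrier) → a ⊕ ⋀ f ≡ ⋀ (λ i → a ⊕ f i)
    ⊕-distrib-⋁ : ∀ {I} (i₀ : I) a (f : I → Carrier) → a ⊕ ⋁ f ≡ ⋁ (λ i → a ⊕ f i)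
    ⊕-distrib-⨂ : ∀ {I} (i₀ : I) a (f : I → Carrier) → a ⊕ ⨂ f ≡ ⨂ (λ i → a ⊕ f i)
    neg : Carrier → Carrier
    neg-invol : ∀ x → neg (neg x) ≡ x
    neg-anti-t : ∀ {x y} → x ≤t y → neg y ≤t neg x
    neg-mono-k : ∀ {x y} → x ≤k y → neg x ≤k neg y

record Signature : Set₁ where
  field
    Func    : Set
    arityF  : Func → ℕ
    PredSym : Set
    arityP  : PredSym → ℕ

module Syntax (S : Signature) where
  open Signature S

  data Term (n : ℕ) : Set where
    var : Fin n → Term n
    fun : (f : Func) → (Fin (arityF f) → Term n) → Term n

  GTerm : Set
  GTerm = Term 0

  inst : ∀ {n} → Term n → (Fin n → GTerm) → GTerm
  inst (var i)    ρ = ρ i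
  inst (fun f ts) ρ = fun f (λ j → inst (ts j) ρ)

  _▸_ : ∀ {n} → (Fin n → GTerm) → GTerm → Fin (suc n) → GTerm
  (ρ ▸ t) zero    = t
  (ρ ▸ t) (suc i) = ρ i

  data Atom (n : ℕ) : Set where
    app   : (P : PredSym) → (Fin (arityP P) → Term n) → Atom n
    equal : Term n → Term n → Atom n

  GAtom : Set
  GAtom = Σ PredSym (λ P → Fin (arityP P) → GTerm)

module Formulas (B : Bilattice) (S : Signature) where
  open Bilattice B
  open Signature S
  open Syntax S

  data Formula (n : ℕ) : Set where
    pos  : Atom n → Formula n
    negl : Atom n → Formula n
    val  : Carrier → Formula n
    _∧ᶠ_ _∨ᶠ_ _⊗ᶠ_ _⊕ᶠ_ : Formula n → Formula n → Formula n
    ∃ᶠ ∀ᶠ : Formula (suc n) → Formula n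

  -- A Fitting program: for every predicate P at most one clause
  -- P(x₀,…,x_{n-1}) ← body, with n = arity of P; finitely many clauses.
  record Program : Set where
    field
      clause : (P : PredSym) → Maybe (Formula (arityP P))
      heads  : List PredSym
      finite : ∀ P φ → clause P ≡ just φ → P ∈ heads

module Semantics (B : Bilattice) (S : Signature) where
  open Bilattice B
  open Signature S
  open Syntax S
  open Formulas B S

  Valuation : Set
  Valuation = GAtom → Carrier

  -- value of the built-in equal(s,t): 𝓣 if s = t, 𝓕 otherwise
  -- (written as the join of 𝓣 over the proofs of s ≡ t)
  eqVal : GTerm → GTerm → Carrier
  eqVal s t = ⋁ {s ≡ t} (λ _ → 𝓣)

  -- contrajoin v △ w, evaluated on the closed instance φ[ρ]
  contra : Valuation → Valuation → ∀ {n} → Formula n → (Fin n → GTerm) → Carrier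
  contra v w (pos (app P ts))    ρ = v (P , λ j → inst (ts j) ρ)
  contra v w (pos (equal s t))   ρ = eqVal (inst s ρ) (inst t ρ)
  contra v w (negl (app P ts))   ρ = neg (w (P , λ j → inst (ts j) ρ))
  contra v w (negl (equal s t))  ρ = neg (eqVal (inst s ρ) (inst t ρ))
  contra v w (val b)             ρ = b
  contra v w (φ ∧ᶠ ψ)            ρ = contra v w φ ρ ∧ contra v w ψ ρ
  contra v w (φ ∨ᶠ ψ)            ρ = contra v w φ ρ ∨ contra v w ψ ρ
  contra v w (φ ⊗ᶠ ψ)            ρ = contra v w φ ρ ⊗ contra v w ψ ρ
  contra v w (φ ⊕ᶠ ψ)            ρ = contra v w φ ρ ⊕ contra v w ψ ρ
  contra v w (∃ᶠ φ)              ρ = ⋁ (λ (t : GTerm) → contra v w φ (ρ ▸ t))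
  contra v w (∀ᶠ φ)              ρ = ⋀ (λ (t : GTerm) → contra v w φ (ρ ▸ t))

  data Corner : Set where
    cF cT cU cI : Corner

  ⟦_⟧ : Corner → Carrier
  ⟦ cF ⟧ = 𝓕
  ⟦ cT ⟧ = 𝓣
  ⟦ cU ⟧ = 𝓤
  ⟦ cI ⟧ = 𝓘

  module _ (𝒫 : Program) (α : Corner) where
    open Program 𝒫

    Ψ : Valuation → Valuation → Valuation
    Ψ v w (P , ts) with clause P
    ... | nothing = ⟦ α ⟧
    ... | just φ  = contra v w φ ts

    lfpₜ gfpₜ lfpₖ gfpₖ : (Valuation → Valuation) → Valuation
    lfpₜ f A = ⋀ (λ (p : Σ Valuation (λ x → ∀ B → f x B ≤t x B)) → proj₁ p A)
    gfpₜ f A = ⋁ (λ (p : Σ Valuation (λ x → ∀ B → x B ≤t f x B)) → proj₁ p A)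
    lfpₖ f A = ⨂ (λ (p : Σ Valuation (λ x → ∀ B → f x B ≤k x B)) → proj₁ p A)
    gfpₖ f A = ⨁ (λ (p : Σ Valuation (λ x → ∀ B → x B ≤k f x B)) → proj₁ p A)

    -- Ψ'^α_𝒫(v): the ≤t-least / ≤t-greatest / ≤k-least / ≤k-greatest
    -- fixpoint of x ↦ Ψ^α_𝒫(x,v) for α = 𝓕 / 𝓣 / 𝓤 / 𝓘 (the limit of the
    -- transfinite iteration described in the paper)
    extreme : Corner → (Valuation → Valuation) → Valuation
    extreme cF = lfpₜ
    extreme cT = gfpₜ
    extreme cU = lfpₖ
    extreme cI = gfpₖ

    Ψ' : Valuation → Valuation
    Ψ' v = extreme α (λ x → Ψ x v)

    FixU FixI : Valuation
    FixU = lfpₖ Ψ'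
    FixI = gfpₖ Ψ'

    FixF FixT : Valuation
    FixF = lfpₜ (λ x → Ψ' (Ψ' x))
    FixT = gfpₜ (λ x → Ψ' (Ψ' x))

module Submission where

-- In an interlaced bilattice, if a ≤t y ≤t b then a ⊗ b ≤k y ≤k a ⊕ b, and
-- dually x ≤k y ≤k z gives x ∧ z ≤t y ≤t x ∨ z. Hence if u and i lie
-- ≤t-between a and b while u ≤k a ⊗ b and a ⊕ b ≤k i, then u = a ⊗ b,
-- i = a ⊕ b, a = u ∧ i and b = u ∨ i.
-- Ψ' is ≤k-monotone and ≤t-antitone. Its ≤k-extreme fixpoints are fixpoints
-- of Ψ' ∘ Ψ', so they lie ≤t-between the oscillation points a and b; and
-- Ψ' swaps a and b, which makes a ⊗ b a ≤k-prefixpoint and a ⊕ b a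
-- ≤k-postfixpoint of Ψ'. The monotonicity of Ψ' comes from the same four
-- identities for the bimonotone map x ↦ Ψ(x, v): they express each of its
-- ≤t-extreme fixpoints through its ≤k-extreme ones and vice versa.

open import Level using (0ℓ)
open import Data.Maybe using (just; nothing)
open import Data.Product using (_×_; Σ; _,_; proj₁)
open import Function using (_∘_)
open import Relation.Binary.Core using (Rel; _Preserves₂_⟶_⟶_)
open import Relation.Binary.Structures using (IsPartialOrder)
open import Relation.Binary.Lattice
  using (Lattice; IsLattice; MeetSemilattice; IsMeetSemilattice)
open import Relation.Binary.PropositionalEquality using (_≡_; _≗_; cong; sym)
  renaming (trans to ≡-trans)
import Relation.Binary.Construct.Flip.EqAndOrd as Flip
import Relation.Binary.Lattice.Properties.Lattice as LatticeProperties
import Relation.Binary.Lattice.Properties.JoinSemilattice as JoinSemilatticeProperties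
import Relation.Binary.Lattice.Properties.MeetSemilattice as MeetSemilatticeProperties
import Relation.Binary.Reasoning.PartialOrder as PartialOrderReasoning
open import Defs

module Interlacing
  {C : Set} {_≤₁_ _≤₂_ : Rel C 0ℓ} {_∨₁_ _∧₁_ _∧₂_ : C → C → C}
  (isLattice₁ : IsLattice _≡_ _≤₁_ _∨₁_ _∧₁_)
  (isMeetSemilattice₂ : IsMeetSemilattice _≡_ _≤₂_ _∧₂_)
  (∧₁-mono₂ : _∧₁_ Preserves₂ _≤₂_ ⟶ _≤₂_ ⟶ _≤₂_)
  (∨₁-mono₂ : _∨₁_ Preserves₂ _≤₂_ ⟶ _≤₂_ ⟶ _≤₂_)
  where

  private
    lattice₁ : Lattice 0ℓ 0ℓ 0ℓ
    lattice₁ = record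
      { Carrier = C ; _≈_ = _≡_ ; _≤_ = _≤₁_ ; _∨_ = _∨₁_ ; _∧_ = _∧₁_
      ; isLattice = isLattice₁
      }

    meetSemilattice₂ : MeetSemilattice 0ℓ 0ℓ 0ℓ
    meetSemilattice₂ = record
      { Carrier = C ; _≈_ = _≡_ ; _≤_ = _≤₂_ ; _∧_ = _∧₂_
      ; isMeetSemilattice = isMeetSemilattice₂
      }

    open LatticeProperties lattice₁ using (∧-absorbs-∨)
    open MeetSemilatticeProperties (Lattice.meetSemilattice lattice₁)
      using (dualJoinSemilattice)
    open JoinSemilatticeProperties (Lattice.joinSemilattice lattice₁)
      using (x≤y⇒x∨y≈y)
    open JoinSemilatticeProperties dualJoinSemilattice
      using () renaming (x≤y⇒x∨y≈y to y≤x⇒x∧y≈y)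
    open IsMeetSemilattice isMeetSemilattice₂ using (x∧y≤x; x∧y≤y)
    open PartialOrderReasoning (MeetSemilattice.poset meetSemilattice₂)

  -- Absorption rewrites a ∧₂ b into a ≤₁-expression to which the
  -- ≤₂-monotonicity of ∧₁ and ∨₁ applies.
  between⇒∧₂≤₂ : ∀ {a y b} → a ≤₁ y → y ≤₁ b → (a ∧₂ b) ≤₂ y
  between⇒∧₂≤₂ {a} {y} {b} a≤y y≤b = begin
    m                     ≡⟨ ∧-absorbs-∨ m (m ∧₂ y) ⟨
    m ∧₁ (m ∨₁ (m ∧₂ y))  ≤⟨ ∧₁-mono₂ (x∧y≤y a b) (∨₁-mono₂ (x∧y≤x a b) (x∧y≤y m y)) ⟩
    b ∧₁ (a ∨₁ y)         ≡⟨ cong (b ∧₁_) (x≤y⇒x∨y≈y a≤y) ⟩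
    b ∧₁ y                ≡⟨ y≤x⇒x∧y≈y y≤b ⟩
    y                     ∎
    where
    m = a ∧₂ b

module KnasterTarski
  {C : Set} {_≤_ : Rel C 0ℓ} (isPartialOrder : IsPartialOrder _≡_ _≤_)
  (⨅ : ∀ {I : Set} → (I → C) → C)
  (⨅-lowerBound : ∀ {I} (f : I → C) i → ⨅ f ≤ f i)
  (⨅-greatest : ∀ {I} (f : I → C) {z} → (∀ i → z ≤ f i) → z ≤ ⨅ f)
  (X : Set)
  where

  open IsPartialOrder isPartialOrder using (trans; antisym; reflexive)

  infix 4 _≤̇_

  _≤̇_ : (X → C) → (X → C) → Set
  x ≤̇ y = ∀ A → x A ≤ y A

  Monotone : ((X → C) → (X → C)) → Set
  Monotone f = ∀ {x y} → x ≤̇ y → f x ≤̇ f y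

  lfp : ((X → C) → (X → C)) → X → C
  lfp f A = ⨅ (λ (p : Σ (X → C) (λ x → ∀ B → f x B ≤ x B)) → proj₁ p A)

  lfp-least : ∀ f {x} → f x ≤̇ x → lfp f ≤̇ x
  lfp-least f {x} fx≤x A = ⨅-lowerBound _ (x , fx≤x)

  lfp-least-fixpoint : ∀ f {x} → f x ≗ x → lfp f ≤̇ x
  lfp-least-fixpoint f fx≗x = lfp-least f (λ A → reflexive (fx≗x A))

  lfp-fixpoint : ∀ f → Monotone f → f (lfp f) ≗ lfp f
  lfp-fixpoint f mono A = antisym (f[lfp]≤lfp A) (lfp-least f (mono f[lfp]≤lfp) A)
    where
    f[lfp]≤lfp : f (lfp f) ≤̇ lfp f
    f[lfp]≤lfp B = ⨅-greatest _ λ (x , fx≤x) → trans (mono (lfp-least f fx≤x) B) (fx≤x B)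

  lfp-mono : ∀ f g → (∀ x → g x ≤̇ f x) → lfp g ≤̇ lfp f
  lfp-mono f g g≤f A =
    ⨅-greatest _ λ (x , fx≤x) → lfp-least g (λ B → trans (g≤f x B) (fx≤x B)) A

module _ (𝔹 : Bilattice) (S : Signature) where
  open Bilattice 𝔹
  open Syntax S
  open Formulas 𝔹 S
  open Semantics 𝔹 S
  open IsPartialOrder ≤t-po using ()
    renaming (refl to reflₜ; antisym to antisymₜ; reflexive to reflexiveₜ)
  open IsPartialOrder ≤k-po using ()
    renaming (refl to reflₖ; trans to transₖ; antisym to antisymₖ; reflexive to reflexiveₖ)

  ≤t-lattice ≤k-lattice : Lattice 0ℓ 0ℓ 0ℓ
  ≤t-lattice = record
    { Carrier = Carrier ; _≈_ = _≡_ ; _≤_ = _≤t_ ; _∨_ = _∨_ ; _∧_ = _∧_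
    ; isLattice = record
      { isPartialOrder = ≤t-po
      ; supremum       = λ x y → ∨-ub₁ x y , ∨-ub₂ x y , λ _ → ∨-lub
      ; infimum        = λ x y → ∧-lb₁ x y , ∧-lb₂ x y , λ _ → ∧-glb
      }
    }
  ≤k-lattice = record
    { Carrier = Carrier ; _≈_ = _≡_ ; _≤_ = _≤k_ ; _∨_ = _⊕_ ; _∧_ = _⊗_
    ; isLattice = record
      { isPartialOrder = ≤k-po
      ; supremum       = λ x y → ⊕-ub₁ x y , ⊕-ub₂ x y , λ _ → ⊕-lub
      ; infimum        = λ x y → ⊗-lb₁ x y , ⊗-lb₂ x y , λ _ → ⊗-glb
      }
    }

  module ≤t-Reasoning = PartialOrderReasoning (Lattice.poset ≤t-lattice)
  module ≤k-Reasoning = PartialOrderReasoning (Lattice.poset ≤k-lattice)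

  open Lattice ≤t-lattice using () renaming (isLattice to ≤t-isLattice)
  open Lattice ≤k-lattice using () renaming (isLattice to ≤k-isLattice)
  open IsLattice (LatticeProperties.∧-∨-isLattice ≤t-lattice) using ()
    renaming (isMeetSemilattice to ≥t-isMeetSemilattice)
  open IsLattice (LatticeProperties.∧-∨-isLattice ≤k-lattice) using ()
    renaming (isMeetSemilattice to ≥k-isMeetSemilattice)

  t-between⇒⊗≤k : ∀ {a y b} → a ≤t y → y ≤t b → (a ⊗ b) ≤k y
  t-between⇒⊗≤k = Interlacing.between⇒∧₂≤₂
    ≤t-isLattice (Lattice.isMeetSemilattice ≤k-lattice) ∧-mono-k ∨-mono-k

  t-between⇒≤k⊕ : ∀ {a y b} → a ≤t y → y ≤t b → y ≤k (a ⊕ b)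
  t-between⇒≤k⊕ = Interlacing.between⇒∧₂≤₂
    ≤t-isLattice ≥k-isMeetSemilattice ∧-mono-k ∨-mono-k

  k-between⇒∧≤t : ∀ {a y b} → a ≤k y → y ≤k b → (a ∧ b) ≤t y
  k-between⇒∧≤t = Interlacing.between⇒∧₂≤₂
    ≤k-isLattice (Lattice.isMeetSemilattice ≤t-lattice) ⊗-mono-t ⊕-mono-t

  k-between⇒≤t∨ : ∀ {a y b} → a ≤k y → y ≤k b → y ≤t (a ∨ b)
  k-between⇒≤t∨ = Interlacing.between⇒∧₂≤₂
    ≤k-isLattice ≥t-isMeetSemilattice ⊗-mono-t ⊕-mono-t

  infixr 7 _∧ᵛ_ _⊗ᵛ_
  infixr 6 _∨ᵛ_ _⊕ᵛ_

  _∧ᵛ_ _∨ᵛ_ _⊗ᵛ_ _⊕ᵛ_ : Valuation → Valuation → Valuation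
  (v ∧ᵛ w) A = v A ∧ w A
  (v ∨ᵛ w) A = v A ∨ w A
  (v ⊗ᵛ w) A = v A ⊗ w A
  (v ⊕ᵛ w) A = v A ⊕ w A

  -- A greatest fixpoint is a least fixpoint for the converse order; these
  -- lfp's are definitionally lfpₜ, gfpₜ, lfpₖ and gfpₖ of Semantics.
  module LFPₜ = KnasterTarski ≤t-po ⋀ ⋀-lb ⋀-glb GAtom
  module GFPₜ = KnasterTarski (Flip.isPartialOrder ≤t-po) ⋁ ⋁-ub ⋁-lub GAtom
  module LFPₖ = KnasterTarski ≤k-po ⨂ ⨂-lb ⨂-glb GAtom
  module GFPₖ = KnasterTarski (Flip.isPartialOrder ≤k-po) ⨁ ⨁-ub ⨁-lub GAtom

  open LFPₜ using () renaming (_≤̇_ to _≤T_)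
  open LFPₖ using () renaming (_≤̇_ to _≤K_)

  record Corners (a b u i : Valuation) : Set where
    field
      u≗a⊗b : u ≗ a ⊗ᵛ b
      i≗a⊕b : i ≗ a ⊕ᵛ b
      a≗u∧i : a ≗ u ∧ᵛ i
      b≗u∨i : b ≗ u ∨ᵛ i

  corners : ∀ {a b u i} → a ≤T u → u ≤T b → a ≤T i → i ≤T b →
            u ≤K a ⊗ᵛ b → a ⊕ᵛ b ≤K i → Corners a b u i
  corners {a} {b} {u} {i} a≤ₜu u≤ₜb a≤ₜi i≤ₜb u≤ₖa⊗b a⊕b≤ₖi = record
    { u≗a⊗b = λ A → antisymₖ (u≤ₖa⊗b A) (t-between⇒⊗≤k (a≤ₜu A) (u≤ₜb A))
    ; i≗a⊕b = λ A → antisymₖ (t-between⇒≤k⊕ (a≤ₜi A) (i≤ₜb A)) (a⊕b≤ₖi A)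
    ; a≗u∧i = λ A → antisymₜ (∧-glb (a≤ₜu A) (a≤ₜi A)) (k-between⇒∧≤t (u≤ₖa A) (a≤ₖi A))
    ; b≗u∨i = λ A → antisymₜ (k-between⇒≤t∨ (u≤ₖb A) (b≤ₖi A)) (∨-lub (u≤ₜb A) (i≤ₜb A))
    }
    where
    u≤ₖa : u ≤K a
    u≤ₖa A = transₖ (u≤ₖa⊗b A) (⊗-lb₁ _ _)
    u≤ₖb : u ≤K b
    u≤ₖb A = transₖ (u≤ₖa⊗b A) (⊗-lb₂ _ _)
    a≤ₖi : a ≤K i
    a≤ₖi A = transₖ (⊕-ub₁ _ _) (a⊕b≤ₖi A)
    b≤ₖi : b ≤K i
    b≤ₖi A = transₖ (⊕-ub₂ _ _) (a⊕b≤ₖi A)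

  extremeFixpoints-corners : ∀ H → LFPₜ.Monotone H → LFPₖ.Monotone H →
    Corners (LFPₜ.lfp H) (GFPₜ.lfp H) (LFPₖ.lfp H) (GFPₖ.lfp H)
  extremeFixpoints-corners H mono-t mono-k = corners
    (LFPₜ.lfp-least-fixpoint H u-fixed) (GFPₜ.lfp-least-fixpoint H u-fixed)
    (LFPₜ.lfp-least-fixpoint H i-fixed) (GFPₜ.lfp-least-fixpoint H i-fixed)
    (λ A → ⊗-glb (LFPₖ.lfp-least-fixpoint H a-fixed A) (LFPₖ.lfp-least-fixpoint H b-fixed A))
    (λ A → ⊕-lub (GFPₖ.lfp-least-fixpoint H a-fixed A) (GFPₖ.lfp-least-fixpoint H b-fixed A))
    where
    a-fixed : H (LFPₜ.lfp H) ≗ LFPₜ.lfp H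
    a-fixed = LFPₜ.lfp-fixpoint H mono-t
    b-fixed : H (GFPₜ.lfp H) ≗ GFPₜ.lfp H
    b-fixed = GFPₜ.lfp-fixpoint H mono-t
    u-fixed : H (LFPₖ.lfp H) ≗ LFPₖ.lfp H
    u-fixed = LFPₖ.lfp-fixpoint H mono-k
    i-fixed : H (GFPₖ.lfp H) ≗ GFPₖ.lfp H
    i-fixed = GFPₖ.lfp-fixpoint H mono-k

  module Oscillation (f : Valuation → Valuation) (f-mono-k : LFPₖ.Monotone f)
                     (f-antitone-t : ∀ {x y} → x ≤T y → f y ≤T f x) where

    f² : Valuation → Valuation
    f² = f ∘ f

    f²-mono-t : LFPₜ.Monotone f²
    f²-mono-t = f-antitone-t ∘ f-antitone-t

    f-cong : ∀ {x y} → x ≗ y → f x ≗ f y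
    f-cong x≗y A = antisymₜ (f-antitone-t (λ B → reflexiveₜ (sym (x≗y B))) A)
                            (f-antitone-t (λ B → reflexiveₜ (x≗y B)) A)

    fixpoint⇒f²-fixpoint : ∀ {x} → f x ≗ x → f² x ≗ x
    fixpoint⇒f²-fixpoint fx≗x A = ≡-trans (f-cong fx≗x A) (fx≗x A)

    f-preserves-f²-fixpoints : ∀ {x} → f² x ≗ x → f² (f x) ≗ f x
    f-preserves-f²-fixpoints = f-cong

    a b : Valuation
    a = LFPₜ.lfp f²
    b = GFPₜ.lfp f²

    a-fixed : f² a ≗ a
    a-fixed = LFPₜ.lfp-fixpoint f² f²-mono-t

    b-fixed : f² b ≗ b
    b-fixed = GFPₜ.lfp-fixpoint f² f²-mono-t

    a≤ : ∀ {x} → f² x ≗ x → a ≤T x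
    a≤ = LFPₜ.lfp-least-fixpoint f²

    ≤b : ∀ {x} → f² x ≗ x → x ≤T b
    ≤b = GFPₜ.lfp-least-fixpoint f²

    f[a]≗b : f a ≗ b
    f[a]≗b A = antisymₜ (≤b (f-preserves-f²-fixpoints a-fixed) A) (begin
      b A        ≡⟨ b-fixed A ⟨
      f (f b) A  ≤⟨ f-antitone-t (a≤ (f-preserves-f²-fixpoints b-fixed)) A ⟩
      f a A      ∎)
      where open ≤t-Reasoning

    f[b]≗a : f b ≗ a
    f[b]≗a A = antisymₜ (begin
      f b A      ≤⟨ f-antitone-t (≤b (f-preserves-f²-fixpoints a-fixed)) A ⟩
      f (f a) A  ≡⟨ a-fixed A ⟩
      a A        ∎) (a≤ (f-preserves-f²-fixpoints b-fixed) A)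
      where open ≤t-Reasoning

    f[a⊗b]≤a⊗b : f (a ⊗ᵛ b) ≤K a ⊗ᵛ b
    f[a⊗b]≤a⊗b A = ⊗-glb
      (transₖ (f-mono-k (λ B → ⊗-lb₂ (a B) (b B)) A) (reflexiveₖ (f[b]≗a A)))
      (transₖ (f-mono-k (λ B → ⊗-lb₁ (a B) (b B)) A) (reflexiveₖ (f[a]≗b A)))

    a⊕b≤f[a⊕b] : a ⊕ᵛ b ≤K f (a ⊕ᵛ b)
    a⊕b≤f[a⊕b] A = ⊕-lub
      (transₖ (reflexiveₖ (sym (f[b]≗a A))) (f-mono-k (λ B → ⊕-ub₂ (a B) (b B)) A))
      (transₖ (reflexiveₖ (sym (f[a]≗b A))) (f-mono-k (λ B → ⊕-ub₁ (a B) (b B)) A))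

    oscillation-corners : Corners a b (LFPₖ.lfp f) (GFPₖ.lfp f)
    oscillation-corners = corners
      (a≤ (fixpoint⇒f²-fixpoint u-fixed)) (≤b (fixpoint⇒f²-fixpoint u-fixed))
      (a≤ (fixpoint⇒f²-fixpoint i-fixed)) (≤b (fixpoint⇒f²-fixpoint i-fixed))
      (LFPₖ.lfp-least f f[a⊗b]≤a⊗b) (GFPₖ.lfp-least f a⊕b≤f[a⊕b])
      where
      u-fixed : f (LFPₖ.lfp f) ≗ LFPₖ.lfp f
      u-fixed = LFPₖ.lfp-fixpoint f f-mono-k
      i-fixed : f (GFPₖ.lfp f) ≗ GFPₖ.lfp f
      i-fixed = GFPₖ.lfp-fixpoint f f-mono-k

  contra-mono-t : ∀ {v v' w w'} → v ≤T v' → w' ≤T w → ∀ {n} (φ : Formula n) ρ →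
                  contra v w φ ρ ≤t contra v' w' φ ρ
  contra-mono-t {v} {v'} {w} {w'} v≤v' w'≤w = go
    where
    go : ∀ {n} (φ : Formula n) ρ → contra v w φ ρ ≤t contra v' w' φ ρ
    go (pos (app P ts))   ρ = v≤v' _
    go (pos (equal s t))  ρ = reflₜ
    go (negl (app P ts))  ρ = neg-anti-t (w'≤w _)
    go (negl (equal s t)) ρ = reflₜ
    go (val β)            ρ = reflₜ
    go (φ ∧ᶠ ψ)           ρ = ∧-mono-t (go φ ρ) (go ψ ρ)
    go (φ ∨ᶠ ψ)           ρ = ∨-mono-t (go φ ρ) (go ψ ρ)
    go (φ ⊗ᶠ ψ)           ρ = ⊗-mono-t (go φ ρ) (go ψ ρ)
    go (φ ⊕ᶠ ψ)           ρ = ⊕-mono-t (go φ ρ) (go ψ ρ)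
    go (∃ᶠ φ)             ρ = ⋁-mono-t λ t → go φ (ρ ▸ t)
    go (∀ᶠ φ)             ρ = ⋀-mono-t λ t → go φ (ρ ▸ t)

  contra-mono-k : ∀ {v v' w w'} → v ≤K v' → w ≤K w' → ∀ {n} (φ : Formula n) ρ →
                  contra v w φ ρ ≤k contra v' w' φ ρ
  contra-mono-k {v} {v'} {w} {w'} v≤v' w≤w' = go
    where
    go : ∀ {n} (φ : Formula n) ρ → contra v w φ ρ ≤k contra v' w' φ ρ
    go (pos (app P ts))   ρ = v≤v' _
    go (pos (equal s t))  ρ = reflₖ
    go (negl (app P ts))  ρ = neg-mono-k (w≤w' _)
    go (negl (equal s t)) ρ = reflₖ
    go (val β)            ρ = reflₖ
    go (φ ∧ᶠ ψ)           ρ = ∧-mono-k (go φ ρ) (go ψ ρ)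
    go (φ ∨ᶠ ψ)           ρ = ∨-mono-k (go φ ρ) (go ψ ρ)
    go (φ ⊗ᶠ ψ)           ρ = ⊗-mono-k (go φ ρ) (go ψ ρ)
    go (φ ⊕ᶠ ψ)           ρ = ⊕-mono-k (go φ ρ) (go ψ ρ)
    go (∃ᶠ φ)             ρ = ⋁-mono-k λ t → go φ (ρ ▸ t)
    go (∀ᶠ φ)             ρ = ⋀-mono-k λ t → go φ (ρ ▸ t)

  module _ (𝒫 : Program) (α : Corner) where
    open Program 𝒫 using (clause)

    Ψ-mono-t : ∀ {v v' w w'} → v ≤T v' → w' ≤T w → Ψ 𝒫 α v w ≤T Ψ 𝒫 α v' w'
    Ψ-mono-t v≤v' w'≤w (P , ts) with clause P
    ... | nothing = reflₜ
    ... | just φ  = contra-mono-t v≤v' w'≤w φ ts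

    Ψ-mono-k : ∀ {v v' w w'} → v ≤K v' → w ≤K w' → Ψ 𝒫 α v w ≤K Ψ 𝒫 α v' w'
    Ψ-mono-k v≤v' w≤w' (P , ts) with clause P
    ... | nothing = reflₖ
    ... | just φ  = contra-mono-k v≤v' w≤w' φ ts

    Ψ[_] : Valuation → Valuation → Valuation
    Ψ[ v ] x = Ψ 𝒫 α x v

    Ψ[]-corners : ∀ v →
      Corners (LFPₜ.lfp Ψ[ v ]) (GFPₜ.lfp Ψ[ v ]) (LFPₖ.lfp Ψ[ v ]) (GFPₖ.lfp Ψ[ v ])
    Ψ[]-corners v = extremeFixpoints-corners Ψ[ v ]
      (λ x≤y → Ψ-mono-t x≤y (λ _ → reflₜ)) (λ x≤y → Ψ-mono-k x≤y (λ _ → reflₖ))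

    module _ {v v' : Valuation} where
      open Corners

      lfpₖ-mono : v ≤K v' → LFPₖ.lfp Ψ[ v ] ≤K LFPₖ.lfp Ψ[ v' ]
      lfpₖ-mono v≤v' = LFPₖ.lfp-mono Ψ[ v' ] Ψ[ v ] λ _ → Ψ-mono-k (λ _ → reflₖ) v≤v'

      gfpₖ-mono : v ≤K v' → GFPₖ.lfp Ψ[ v ] ≤K GFPₖ.lfp Ψ[ v' ]
      gfpₖ-mono v≤v' = GFPₖ.lfp-mono Ψ[ v ] Ψ[ v' ] λ _ → Ψ-mono-k (λ _ → reflₖ) v≤v'

      lfpₜ-antitone : v ≤T v' → LFPₜ.lfp Ψ[ v' ] ≤T LFPₜ.lfp Ψ[ v ]
      lfpₜ-antitone v≤v' = LFPₜ.lfp-mono Ψ[ v ] Ψ[ v' ] λ _ → Ψ-mono-t (λ _ → reflₜ) v≤v'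

      gfpₜ-antitone : v ≤T v' → GFPₜ.lfp Ψ[ v' ] ≤T GFPₜ.lfp Ψ[ v ]
      gfpₜ-antitone v≤v' = GFPₜ.lfp-mono Ψ[ v' ] Ψ[ v ] λ _ → Ψ-mono-t (λ _ → reflₜ) v≤v'

      extreme-mono-k : ∀ β → v ≤K v' → extreme 𝒫 α β Ψ[ v ] ≤K extreme 𝒫 α β Ψ[ v' ]
      extreme-mono-k cF v≤v' A = begin
        LFPₜ.lfp Ψ[ v ] A                        ≡⟨ a≗u∧i (Ψ[]-corners v) A ⟩
        LFPₖ.lfp Ψ[ v ] A ∧ GFPₖ.lfp Ψ[ v ] A    ≤⟨ ∧-mono-k (lfpₖ-mono v≤v' A) (gfpₖ-mono v≤v' A) ⟩
        LFPₖ.lfp Ψ[ v' ] A ∧ GFPₖ.lfp Ψ[ v' ] A  ≡⟨ a≗u∧i (Ψ[]-corners v') A ⟨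
        LFPₜ.lfp Ψ[ v' ] A                       ∎
        where open ≤k-Reasoning
      extreme-mono-k cT v≤v' A = begin
        GFPₜ.lfp Ψ[ v ] A                        ≡⟨ b≗u∨i (Ψ[]-corners v) A ⟩
        LFPₖ.lfp Ψ[ v ] A ∨ GFPₖ.lfp Ψ[ v ] A    ≤⟨ ∨-mono-k (lfpₖ-mono v≤v' A) (gfpₖ-mono v≤v' A) ⟩
        LFPₖ.lfp Ψ[ v' ] A ∨ GFPₖ.lfp Ψ[ v' ] A  ≡⟨ b≗u∨i (Ψ[]-corners v') A ⟨
        GFPₜ.lfp Ψ[ v' ] A                       ∎
        where open ≤k-Reasoning
      extreme-mono-k cU = lfpₖ-mono
      extreme-mono-k cI = gfpₖ-mono

      extreme-antitone-t : ∀ β → v ≤T v' → extreme 𝒫 α β Ψ[ v' ] ≤T extreme 𝒫 α β Ψ[ v ]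
      extreme-antitone-t cF = lfpₜ-antitone
      extreme-antitone-t cT = gfpₜ-antitone
      extreme-antitone-t cU v≤v' A = begin
        LFPₖ.lfp Ψ[ v' ] A                       ≡⟨ u≗a⊗b (Ψ[]-corners v') A ⟩
        LFPₜ.lfp Ψ[ v' ] A ⊗ GFPₜ.lfp Ψ[ v' ] A  ≤⟨ ⊗-mono-t (lfpₜ-antitone v≤v' A) (gfpₜ-antitone v≤v' A) ⟩
        LFPₜ.lfp Ψ[ v ] A ⊗ GFPₜ.lfp Ψ[ v ] A    ≡⟨ u≗a⊗b (Ψ[]-corners v) A ⟨
        LFPₖ.lfp Ψ[ v ] A                        ∎
        where open ≤t-Reasoning
      extreme-antitone-t cI v≤v' A = begin
        GFPₖ.lfp Ψ[ v' ] A                       ≡⟨ i≗a⊕b (Ψ[]-corners v') A ⟩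
        LFPₜ.lfp Ψ[ v' ] A ⊕ GFPₜ.lfp Ψ[ v' ] A  ≤⟨ ⊕-mono-t (lfpₜ-antitone v≤v' A) (gfpₜ-antitone v≤v' A) ⟩
        LFPₜ.lfp Ψ[ v ] A ⊕ GFPₜ.lfp Ψ[ v ] A    ≡⟨ i≗a⊕b (Ψ[]-corners v) A ⟨
        GFPₖ.lfp Ψ[ v ] A                        ∎
        where open ≤t-Reasoning

    Fix-corners : Corners (FixF 𝒫 α) (FixT 𝒫 α) (FixU 𝒫 α) (FixI 𝒫 α)
    Fix-corners = Oscillation.oscillation-corners
      (Ψ' 𝒫 α) (extreme-mono-k α) (extreme-antitone-t α)

theorem3 : (B : Bilattice) (S : Signature) (𝒫 : Formulas.Program B S)
           (α : Semantics.Corner B S) →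
           let open Bilattice B
               open Syntax S
               open Semantics B S
           in ((A : GAtom) → FixU 𝒫 α A ≡ (FixF 𝒫 α A ⊗ FixT 𝒫 α A))
              × ((A : GAtom) → FixI 𝒫 α A ≡ (FixF 𝒫 α A ⊕ FixT 𝒫 α A))
              × ((A : GAtom) → FixF 𝒫 α A ≡ (FixU 𝒫 α A ∧ FixI 𝒫 α A))
              × ((A : GAtom) → FixT 𝒫 α A ≡ (FixU 𝒫 α A ∨ FixI 𝒫 α A))
theorem3 B S 𝒫 α = u≗a⊗b , i≗a⊕b , a≗u∧i , b≗u∨i
  where open Corners (Fix-corners B S 𝒫 α)
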